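{- Let $1311_{1316}$ be the finite integral relation algebra with atoms $1',a,b,r,\breve{r}$, where $a,b$ are self-converse and $r,\breve{r}$ are distinct converses of each other, in which for diversity atoms $x,y$ we have $1'\le x;y$ iff $y=\breve{x}$, and for diversity atoms $x,y,z$ we have $z\le x;y$ unless either $x=y=z=a$, or $x=y=z=b$, or ($x,y,z\in\{r,\breve{r}\}$ and $z\in\{x,y\}$). Then $1311_{1316}$ has no representation on a set of $28$ points, and no representation on a set of $29$ points.
   Context: A representation of a finite integral relation algebra on a set $U$ is an assignment of a nonempty binary relation $R_x\subseteq U\times U$ to each atom $x$ such that $R_{1'}$ is the identity relation on $U$, the relations $R_x$ partition $U\times U$, $R_{\breve{x}}$ is the converse of $R_x$, and for all atoms $x,y$, the relational composition $R_x\circ R_y$ equals $\bigcup\{R_z : z\le x;y\}$. "Representable over $n$ points" means there is such a representation with $|U|=n$. -}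

module Defs where

open import Data.Bool using (Bool; true; false; _∧_; _∨_; not; T)
open import Data.Nat using (ℕ)
open import Data.Fin using (Fin)
open import Data.Product using (Σ; _×_; ∃; ∃-syntax)
open import Relation.Binary.PropositionalEquality using (_≡_)

data Atom : Set where
  one' a b r r˘ : Atom

conv : Atom → Atom
conv one' = one'
conv a    = a
conv b    = b
conv r    = r˘
conv r˘   = r

_==_ : Atom → Atom → Bool
one' == one' = true
a    == a    = true
b    == b    = true
r    == r    = true
r˘   == r˘   = true
_    == _    = false

isRR : Atom → Bool
isRR r  = true
isRR r˘ = true
isRR _  = false

forbidden : Atom → Atom → Atom → Bool
forbidden a a a = true
forbidden b b b = true
forbidden x y z = isRR x ∧ isRR y ∧ isRR z ∧ ((z == x) ∨ (z == y))

-- leq z x y = true  iff  z ≤ x ; y  (for atoms x, y, z)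
leq : Atom → Atom → Atom → Bool
leq z one' y = z == y
leq z x one' = z == x
leq one' x y = y == conv x
leq z x y    = not (forbidden x y z)

record Representation (n : ℕ) : Set₁ where
  field
    R          : Atom → Fin n → Fin n → Set
    nonempty   : ∀ x → ∃[ u ] ∃[ v ] R x u v
    identity⇒  : ∀ u v → R one' u v → u ≡ v
    identity⇐  : ∀ u → R one' u u
    cover      : ∀ u v → ∃[ x ] R x u v
    disjoint   : ∀ x y u v → R x u v → R y u v → x ≡ y
    converse⇒  : ∀ x u v → R (conv x) u v → R x v u
    converse⇐  : ∀ x u v → R x v u → R (conv x) u v
    compose⇒   : ∀ x y u w → (∃[ v ] (R x u v × R y v w))
                   → ∃[ z ] (T (leq z x y) × R z u w)
    compose⇐   : ∀ x y z u w → T (leq z x y) → R z u w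
                   → ∃[ v ] (R x u v × R y v w)

RepresentableOver : ℕ → Set₁
RepresentableOver n = Representation n

-- Call a list of points a B-clique when any two of them are related by an atom of B, a set of
-- diversity atoms. Fix v in a B-clique S: the other points fall into fibres according to their atom
-- y from v, and for w, w' in the y-fibre the triangle v w w' gives y ≤ y ; z where z relates w to w'.
-- So every fibre is a B_y-clique with B_y = {z ∈ B : y ≤ y ; z}, and |S| ≤ β(B) := 1 + Σ_{y ∈ B} β(B_y).
-- No diversity atom y of 1311_{1316} has y ≤ y ; y, so B_y is smaller than B and the recursion ends.
-- All points of a representation form an {a, b, r, r˘}-clique, and β{a, b, r, r˘} = 1 + 8 + 8 + 5 + 5 = 27.
module Submission where

open import Defs
open import Data.Bool using (T)
open import Data.Bool.Properties using (T?)
open import Data.Fin using (Fin)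
open import Data.List using (List; []; _∷_; length; filter; allFin)
open import Data.List.Properties using (length-tabulate; filter-notAll)
open import Data.List.Membership.Propositional using (_∈_; _∉_)
open import Data.List.Membership.Propositional.Properties using (∈-filter⁺; ∈-filter⁻)
open import Data.List.Relation.Unary.All as All using (All; []; _∷_)
import Data.List.Relation.Unary.All.Properties as All
open import Data.List.Relation.Unary.Any as Any using (here; there)
open import Data.List.Relation.Unary.AllPairs as AllPairs using (AllPairs; []; _∷_)
import Data.List.Relation.Unary.AllPairs.Properties as AllPairs
open import Data.List.Relation.Unary.Unique.Propositional.Properties using (allFin⁺)
open import Data.Nat using (ℕ; zero; suc; _+_; _≤_; s≤s; s≤s⁻¹; z≤n)
open import Data.Nat.Properties using (≤-refl; ≤-trans; +-mono-≤; +-suc; n≤1+n; ≤⇒≯; module ≤-Reasoning)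
open import Data.Product using (_×_; _,_; proj₁; proj₂)
open import Function using (_∘_; id)
open import Relation.Binary.Definitions using (DecidableEquality)
open import Relation.Binary.PropositionalEquality using (_≡_; _≢_; refl; sym; trans; subst; cong)
open import Relation.Nullary using (¬_; yes; no; contradiction)
open import Relation.Nullary.Decidable using (map′)
open import Relation.Unary using (Pred; Decidable)
open import Relation.Unary.Properties using (∁?)

==⇒≡ : ∀ {x y} → T (x == y) → x ≡ y
==⇒≡ {one'} {one'} _ = refl
==⇒≡ {a}    {a}    _ = refl
==⇒≡ {b}    {b}    _ = refl
==⇒≡ {r}    {r}    _ = refl
==⇒≡ {r˘}   {r˘}   _ = refl

==-refl : ∀ x → T (x == x)
==-refl one' = _
==-refl a    = _
==-refl b    = _
==-refl r    = _
==-refl r˘   = _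

_≟_ : DecidableEquality Atom
x ≟ y = map′ ==⇒≡ (λ { refl → ==-refl x }) (T? (x == y))

diversityAtoms : List Atom
diversityAtoms = a ∷ b ∷ r ∷ r˘ ∷ []

∈-diversityAtoms : ∀ {x} → x ≢ one' → x ∈ diversityAtoms
∈-diversityAtoms {one'} x≢1' = contradiction refl x≢1'
∈-diversityAtoms {a}    _    = here refl
∈-diversityAtoms {b}    _    = there (here refl)
∈-diversityAtoms {r}    _    = there (there (here refl))
∈-diversityAtoms {r˘}   _    = there (there (there (here refl)))

one'∉diversityAtoms : one' ∉ diversityAtoms
one'∉diversityAtoms (there (there (there (there ()))))

diversity-not-self-compatible : ∀ {y} → y ≢ one' → ¬ T (leq y y y)
diversity-not-self-compatible {one'} y≢1' = contradiction refl y≢1'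
diversity-not-self-compatible {a}    _    = λ ()
diversity-not-self-compatible {b}    _    = λ ()
diversity-not-self-compatible {r}    _    = λ ()
diversity-not-self-compatible {r˘}   _    = λ ()

compatible? : (y : Atom) → Decidable (λ z → T (leq y y z))
compatible? y z = T? (leq y y z)

-- k is fuel: cliqueBound k B = β(B) as soon as length B ≤ k.
mutual
  cliqueBound : ℕ → List Atom → ℕ
  cliqueBound zero    B = 1
  cliqueBound (suc k) B = suc (fibreBound k B B)

  fibreBound : ℕ → List Atom → List Atom → ℕ
  fibreBound k B []      = 0
  fibreBound k B (y ∷ A) = cliqueBound k (filter (compatible? y) B) + fibreBound k B A

cliqueBound-diversityAtoms : cliqueBound 4 diversityAtoms ≡ 27
cliqueBound-diversityAtoms = refl

length-filter-∁ : ∀ {ℓ p} {X : Set ℓ} {P : Pred X p} (P? : Decidable P) (xs : List X) →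
                  length xs ≡ length (filter P? xs) + length (filter (∁? P?) xs)
length-filter-∁ P? []       = refl
length-filter-∁ P? (x ∷ xs) with P? x
... | yes _ = cong suc (length-filter-∁ P? xs)
... | no  _ = trans (cong suc (length-filter-∁ P? xs)) (sym (+-suc _ _))

length-filter-compatible< : ∀ {k y B} → length B ≤ suc k → one' ∉ B → y ∈ B →
                            length (filter (compatible? y) B) ≤ k
length-filter-compatible< {y = y} {B} B≤1+k one'∉B y∈B =
  s≤s⁻¹ (≤-trans (filter-notAll (compatible? y) B (Any.map y-incompatible y∈B)) B≤1+k)
  where
  y-incompatible : ∀ {x} → y ≡ x → ¬ T (leq y y x)
  y-incompatible refl = diversity-not-self-compatible {y} λ { refl → one'∉B y∈B }

module _ {n : ℕ} (ρ : Representation n) where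
  open Representation ρ

  col : Fin n → Fin n → Atom
  col u v = proj₁ (cover u v)

  col-unique : ∀ {x u v} → R x u v → col u v ≡ x
  col-unique {x} {u} {v} = disjoint _ x u v (proj₂ (cover u v))

  col≡one'⇒≡ : ∀ {u v} → col u v ≡ one' → u ≡ v
  col≡one'⇒≡ {u} {v} eq = identity⇒ u v (subst (λ x → R x u v) eq (proj₂ (cover u v)))

  col-composition : ∀ u v w → T (leq (col u w) (col u v) (col v w))
  col-composition u v w
    with compose⇒ (col u v) (col v w) u w (v , proj₂ (cover u v) , proj₂ (cover v w))
  ... | z , z≤uv∘vw , Rz rewrite col-unique Rz = z≤uv∘vw

  fibre-compatible : ∀ {v w w' y} → col v w ≡ y → col v w' ≡ y → T (leq y y (col w w'))
  fibre-compatible {v} {w} {w'} refl vw'≡y =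
    subst (λ x → T (leq x (col v w) (col w w'))) vw'≡y (col-composition v w w')

  Clique : List Atom → List (Fin n) → Set
  Clique B = AllPairs (λ u v → col u v ∈ B)

  fibre-clique : ∀ {v y B F} → All (λ w → col v w ≡ y) F → Clique B F →
                 Clique (filter (compatible? y) B) F
  fibre-clique         []            []                = []
  fibre-clique {y = y} (vw≡y ∷ vF≡y) (wF ∷ F-clique) =
    All.zipWith (λ (vw'≡y , ww'∈B) → ∈-filter⁺ (compatible? y) ww'∈B (fibre-compatible vw≡y vw'≡y))
                (vF≡y , wF)
    ∷ fibre-clique vF≡y F-clique

  mutual
    clique-size : ∀ k {B S} → length B ≤ k → one' ∉ B → Clique B S → length S ≤ cliqueBound k B
    clique-size k       _    _      []                    = z≤n
    clique-size zero    {[]} _      _ ([] ∷ [])           = ≤-refl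
    clique-size zero    {[]} _      _ ((() ∷ _) ∷ _)
    clique-size (suc k) B≤1+k one'∉B (vS ∷ S-clique) =
      s≤s (fibre-size k _ (length-filter-compatible< B≤1+k one'∉B) one'∉B vS S-clique)

    fibre-size : ∀ k {B A T} v → (∀ {y} → y ∈ A → length (filter (compatible? y) B) ≤ k) →
                 one' ∉ B → All (λ w → col v w ∈ A) T → Clique B T → length T ≤ fibreBound k B A
    fibre-size k {A = []} _ _ _ []       _ = z≤n
    fibre-size k {A = []} _ _ _ (() ∷ _) _
    fibre-size k {B} {y ∷ A} {T} v B-shrinks one'∉B vT T-clique = begin
      length T                                    ≡⟨ length-filter-∁ (λ w → col v w ≟ y) T ⟩
      length F + length F̅                         ≤⟨ +-mono-≤ F-size F̅-size ⟩
      cliqueBound k (filter (compatible? y) B) + fibreBound k B A ∎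
      where
      open ≤-Reasoning
      F F̅ : List (Fin n)
      F  = filter (λ w → col v w ≟ y) T
      F̅ = filter (∁? (λ w → col v w ≟ y)) T
      F-size : length F ≤ cliqueBound k (filter (compatible? y) B)
      F-size = clique-size k (B-shrinks (here refl)) (one'∉B ∘ proj₁ ∘ ∈-filter⁻ _)
                 (fibre-clique (All.all-filter _ T) (AllPairs.filter⁺ _ T-clique))
      F̅-colours : All (λ w → col v w ∈ A) F̅
      F̅-colours = All.zipWith (λ { (here vw≡y , vw≢y) → contradiction vw≡y vw≢y
                                 ; (there vw∈A , _)   → vw∈A })
                              (All.filter⁺ _ vT , All.all-filter _ T)
      F̅-size : length F̅ ≤ fibreBound k B A
      F̅-size = fibre-size k v (B-shrinks ∘ there) one'∉B F̅-colours (AllPairs.filter⁺ _ T-clique)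

  allFin-clique : Clique diversityAtoms (allFin n)
  allFin-clique = AllPairs.map (λ u≢v → ∈-diversityAtoms (u≢v ∘ col≡one'⇒≡)) (allFin⁺ n)

  representation-size≤27 : n ≤ 27
  representation-size≤27 = begin
    n                              ≡⟨ sym (length-tabulate id) ⟩
    length (allFin n)              ≤⟨ clique-size 4 ≤-refl one'∉diversityAtoms allFin-clique ⟩
    cliqueBound 4 diversityAtoms   ≡⟨ cliqueBound-diversityAtoms ⟩
    27                             ∎
    where open ≤-Reasoning

no-representation : ∀ {n} → 28 ≤ n → ¬ RepresentableOver n
no-representation 28≤n ρ = ≤⇒≯ (representation-size≤27 ρ) 28≤n

mainTheorem4 : ¬ RepresentableOver 28 × ¬ RepresentableOver 29
mainTheorem4 = no-representation ≤-refl , no-representation (n≤1+n 28)
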